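{- For every positive integer $n$, \[ \sum_{m=1}^{2^{n-1}} g(2m-1)=6^{\,n-1}. \]
   Context: For a positive integer $m$, the chocolate game $C_{m,m}$ is a two-player impartial game on an $m\times m$ chocolate bar of unit cells, exactly one of which is poisoned (known to both players); cells are $(i,j)$ with $1\le i,j\le m$. Players alternately break the current bar along a grid line into two rectangular pieces, eat one and pass the other (always keeping the poisoned cell); a player who receives the $1\times1$ bar loses. A cell is a P-position if with poison there the second player has a winning strategy; $P_{m,m}$ is the set of P-positions. It is known that $(i,j)\in P_{m,m}$ iff $(i-1)\oplus(j-1)\oplus(m-i)\oplus(m-j)=0$ ($\oplus$ = bitwise XOR). Define $g(m)=\#P_{m,m}$. -}

module Defs where

open import Data.Nat using (ℕ; zero; suc; _+_; _*_; _∸_; _^_; _≡ᵇ_)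
open import Data.Nat.DivMod using (_/_; _%_)
open import Data.Bool using (Bool; true; false; if_then_else_)
open import Data.Nat.ListAction using (sum)
open import Data.List using (List; map; filter; length; applyUpTo; concatMap)
open import Relation.Binary.PropositionalEquality using (_≡_)
open import Data.Nat using (_≟_)

-- Bitwise XOR on ℕ, computed with a fuel parameter (fuel ≥ number of bits
-- of the arguments suffices; we use fuel = a + b, which is always enough).
xorFuel : ℕ → ℕ → ℕ → ℕ
xorFuel zero    a b = 0
xorFuel (suc k) a b =
  (if (a % 2) ≡ᵇ (b % 2) then 0 else 1) + 2 * xorFuel k (a / 2) (b / 2)

infixl 6 _⊕_
_⊕_ : ℕ → ℕ → ℕ
a ⊕ b = xorFuel (a + b) a b

-- Cell (i , j) with 1 ≤ i , j ≤ m is a P-position of C_{m,m} iff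
-- (i-1) ⊕ (j-1) ⊕ (m-i) ⊕ (m-j) = 0.
isP : ℕ → ℕ → ℕ → Bool
isP m i j = ((i ∸ 1) ⊕ (j ∸ 1) ⊕ (m ∸ i) ⊕ (m ∸ j)) ≡ᵇ 0

range1 : ℕ → List ℕ
range1 m = applyUpTo suc m

g : ℕ → ℕ
g m = sum (concatMap (λ i → map (λ j → if isP m i j then 1 else 0) (range1 m)) (range1 m))

sumFrom1 : ℕ → (ℕ → ℕ) → ℕ
sumFrom1 N f = sum (map f (range1 N))

-- Write every number as its lowest binary digit and its half, b ∷ᵇ n = 2 n + b.  As ⊕ acts
-- digitwise, a cell is a P-position iff the low digits of its four distances to the edges
-- XOR to 0 and the halved cell is a P-position of the halved bar.  The low digits always XOR
-- to the parity of m + n for an m × n bar, so bars with sides of different parity have no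
-- P-positions, while for squares g (2k) = 4 g k and g (2k+1) = g (k+1) + g k.  For
-- S N = Σ_{k<N} g k and O N = Σ_{k<N} g (2k+1) this gives O N = 2 S N + g N and
-- S (2N) = 4 S N + O N, hence O (2N) = 6 O N, and O (2^j) = 6^j since O 1 = 1.
module Submission where

open import Defs
open import Algebra.Properties.CommutativeSemigroup using (interchange)
open import Data.Bool using (Bool; true; false; not; _xor_; if_then_else_)
open import Data.List using (List; []; _∷_; [_]; _++_; map; concat; applyUpTo)
open import Data.List.Properties using (map-applyUpTo; applyUpTo-∷ʳ; map-∘)
open import Data.Nat using (ℕ; zero; suc; _+_; _*_; _∸_; _^_; _≤_; _≤′_; ≤′-refl; ≤′-step; z≤n; s≤s; _≡ᵇ_)
open import Data.Nat.DivMod using (_/_; _%_; m/n≡1+[m∸n]/n)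
open import Data.Nat.ListAction using (sum)
open import Data.Nat.ListAction.Properties using (sum-++)
open import Data.Nat.Properties
  using (+-assoc; +-identityʳ; *-zeroʳ; *-distribˡ-+; +-commutativeSemigroup; +-mono-≤;
         ≤-trans; m≤m+n; m≤n+m; m≤n⇒m≤1+n; ≤′⇒≤; ≤⇒≤′)
open import Data.Nat.Tactic.RingSolver using (solve-∀)
open import Function using (_∘_)
open import Relation.Binary.PropositionalEquality
  using (_≡_; refl; sym; trans; cong; cong₂; module ≡-Reasoning)

double : ℕ → ℕ
double zero    = zero
double (suc n) = suc (suc (double n))

infixr 8 _∷ᵇ_

_∷ᵇ_ : Bool → ℕ → ℕ
false ∷ᵇ n = double n
true  ∷ᵇ n = suc (double n)

bit : Bool → ℕ
bit false = 0
bit true  = 1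

data Binary : ℕ → Set where
  bin : ∀ b n → Binary (b ∷ᵇ n)

binary : ∀ n → Binary n
binary zero          = bin false 0
binary (suc zero)    = bin true 0
binary (suc (suc n)) with binary n
... | bin false m = bin false (suc m)
... | bin true  m = bin true (suc m)

double≡2* : ∀ n → double n ≡ 2 * n
double≡2* zero    = refl
double≡2* (suc n) = begin
  suc (suc (double n)) ≡⟨ cong (suc ∘ suc) (double≡2* n) ⟩
  suc (suc (2 * n))    ≡⟨ 2+2n≡2[1+n] n ⟩
  2 * suc n            ∎
  where
  open ≡-Reasoning
  2+2n≡2[1+n] : ∀ n → suc (suc (2 * n)) ≡ 2 * suc n
  2+2n≡2[1+n] = solve-∀

∷ᵇ-%2 : ∀ b n → (b ∷ᵇ n) % 2 ≡ bit b
∷ᵇ-%2 false zero    = refl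
∷ᵇ-%2 true  zero    = refl
∷ᵇ-%2 false (suc n) = ∷ᵇ-%2 false n
∷ᵇ-%2 true  (suc n) = ∷ᵇ-%2 true n

[2+m]/2≡1+m/2 : ∀ m → (2 + m) / 2 ≡ 1 + m / 2
[2+m]/2≡1+m/2 m = m/n≡1+[m∸n]/n {2 + m} (s≤s (s≤s z≤n))

∷ᵇ-/2 : ∀ b n → (b ∷ᵇ n) / 2 ≡ n
∷ᵇ-/2 false zero    = refl
∷ᵇ-/2 true  zero    = refl
∷ᵇ-/2 false (suc n) = trans ([2+m]/2≡1+m/2 (false ∷ᵇ n)) (cong suc (∷ᵇ-/2 false n))
∷ᵇ-/2 true  (suc n) = trans ([2+m]/2≡1+m/2 (true ∷ᵇ n)) (cong suc (∷ᵇ-/2 true n))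

≤-∷ᵇ : ∀ b n → n ≤ b ∷ᵇ n
≤-∷ᵇ false zero    = z≤n
≤-∷ᵇ true  zero    = z≤n
≤-∷ᵇ false (suc n) = s≤s (m≤n⇒m≤1+n (≤-∷ᵇ false n))
≤-∷ᵇ true  (suc n) = s≤s (m≤n⇒m≤1+n (≤-∷ᵇ true n))

∷ᵇ-≤-suc⇒≤ : ∀ b n {k} → b ∷ᵇ n ≤ suc k → n ≤ k
∷ᵇ-≤-suc⇒≤ b     zero    _                = z≤n
∷ᵇ-≤-suc⇒≤ false (suc n) (s≤s (s≤s le)) = s≤s (∷ᵇ-≤-suc⇒≤ false n (m≤n⇒m≤1+n le))
∷ᵇ-≤-suc⇒≤ true  (suc n) (s≤s (s≤s le)) = s≤s (∷ᵇ-≤-suc⇒≤ true n (m≤n⇒m≤1+n le))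

xorFuel-∷ᵇ : ∀ k α a β b → xorFuel (suc k) (α ∷ᵇ a) (β ∷ᵇ b) ≡ (α xor β) ∷ᵇ xorFuel k a b
xorFuel-∷ᵇ k α a β b rewrite ∷ᵇ-%2 α a | ∷ᵇ-%2 β b | ∷ᵇ-/2 α a | ∷ᵇ-/2 β b with α | β
... | false | false = sym (double≡2* (xorFuel k a b))
... | false | true  = cong suc (sym (double≡2* (xorFuel k a b)))
... | true  | false = cong suc (sym (double≡2* (xorFuel k a b)))
... | true  | true  = sym (double≡2* (xorFuel k a b))

xorFuel-suc : ∀ {k a b} → a ≤ k → b ≤ k → xorFuel (suc k) a b ≡ xorFuel k a b
xorFuel-suc {zero}          z≤n     z≤n     = refl
xorFuel-suc {suc k} {a} {b} a≤1+k b≤1+k with binary a | binary b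
... | bin α a₀ | bin β b₀ = begin
  xorFuel (2 + k) (α ∷ᵇ a₀) (β ∷ᵇ b₀)  ≡⟨ xorFuel-∷ᵇ (suc k) α a₀ β b₀ ⟩
  (α xor β) ∷ᵇ xorFuel (suc k) a₀ b₀   ≡⟨ cong ((α xor β) ∷ᵇ_) (xorFuel-suc a₀≤k b₀≤k) ⟩
  (α xor β) ∷ᵇ xorFuel k a₀ b₀         ≡⟨ xorFuel-∷ᵇ k α a₀ β b₀ ⟨
  xorFuel (suc k) (α ∷ᵇ a₀) (β ∷ᵇ b₀)  ∎
  where
  open ≡-Reasoning
  a₀≤k = ∷ᵇ-≤-suc⇒≤ α a₀ a≤1+k
  b₀≤k = ∷ᵇ-≤-suc⇒≤ β b₀ b≤1+k

xorFuel-mono : ∀ {k k′ a b} → a ≤ k → b ≤ k → k ≤′ k′ → xorFuel k′ a b ≡ xorFuel k a b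
xorFuel-mono a≤k b≤k ≤′-refl           = refl
xorFuel-mono a≤k b≤k (≤′-step k≤′k′) = trans
  (xorFuel-suc (≤-trans a≤k (≤′⇒≤ k≤′k′)) (≤-trans b≤k (≤′⇒≤ k≤′k′)))
  (xorFuel-mono a≤k b≤k k≤′k′)

⊕-∷ᵇ : ∀ α a β b → (α ∷ᵇ a) ⊕ (β ∷ᵇ b) ≡ (α xor β) ∷ᵇ (a ⊕ b)
⊕-∷ᵇ α a β b = begin
  xorFuel (A + B) A B               ≡⟨ xorFuel-suc (m≤m+n A B) (m≤n+m B A) ⟨
  xorFuel (suc (A + B)) A B         ≡⟨ xorFuel-∷ᵇ (A + B) α a β b ⟩
  (α xor β) ∷ᵇ xorFuel (A + B) a b  ≡⟨ cong ((α xor β) ∷ᵇ_) (xorFuel-mono (m≤m+n a b) (m≤n+m b a) a+b≤′A+B) ⟩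
  (α xor β) ∷ᵇ (a ⊕ b)              ∎
  where
  open ≡-Reasoning
  A = α ∷ᵇ a
  B = β ∷ᵇ b
  a+b≤′A+B : a + b ≤′ A + B
  a+b≤′A+B = ≤⇒≤′ (+-mono-≤ (≤-∷ᵇ α a) (≤-∷ᵇ β b))

pCell : ℕ → ℕ → ℕ → ℕ → ℕ
pCell x y x′ y′ = if x ⊕ y ⊕ x′ ⊕ y′ ≡ᵇ 0 then 1 else 0

pCell-∷ᵇ : ∀ α β γ δ a b c d →
  pCell (α ∷ᵇ a) (β ∷ᵇ b) (γ ∷ᵇ c) (δ ∷ᵇ d) ≡ (if ((α xor β) xor γ) xor δ then 0 else pCell a b c d)
pCell-∷ᵇ α β γ δ a b c d
  rewrite ⊕-∷ᵇ α a β b | ⊕-∷ᵇ (α xor β) (a ⊕ b) γ c | ⊕-∷ᵇ ((α xor β) xor γ) (a ⊕ b ⊕ c) δ d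
  = ∷ᵇ-isZero (((α xor β) xor γ) xor δ) (a ⊕ b ⊕ c ⊕ d)
  where
  ∷ᵇ-isZero : ∀ p n → (if p ∷ᵇ n ≡ᵇ 0 then 1 else 0) ≡ (if p then 0 else if n ≡ᵇ 0 then 1 else 0)
  ∷ᵇ-isZero false zero    = refl
  ∷ᵇ-isZero false (suc n) = refl
  ∷ᵇ-isZero true  n       = refl

sum-applyUpTo-cong : ∀ {f h : ℕ → ℕ} n → (∀ i → f i ≡ h i) → sum (applyUpTo f n) ≡ sum (applyUpTo h n)
sum-applyUpTo-cong zero    f≗h = refl
sum-applyUpTo-cong (suc n) f≗h = cong₂ _+_ (f≗h 0) (sum-applyUpTo-cong n (f≗h ∘ suc))

sum-applyUpTo-0 : ∀ {f : ℕ → ℕ} n → (∀ i → f i ≡ 0) → sum (applyUpTo f n) ≡ 0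
sum-applyUpTo-0 zero    f≗0 = refl
sum-applyUpTo-0 (suc n) f≗0 = cong₂ _+_ (f≗0 0) (sum-applyUpTo-0 n (f≗0 ∘ suc))

sum-applyUpTo-+ : ∀ (f h : ℕ → ℕ) n →
  sum (applyUpTo (λ i → f i + h i) n) ≡ sum (applyUpTo f n) + sum (applyUpTo h n)
sum-applyUpTo-+ f h zero    = refl
sum-applyUpTo-+ f h (suc n) = begin
  f 0 + h 0 + sum (applyUpTo (λ i → f (suc i) + h (suc i)) n)  ≡⟨ cong (f 0 + h 0 +_) (sum-applyUpTo-+ (f ∘ suc) (h ∘ suc) n) ⟩
  f 0 + h 0 + (F + H)                                          ≡⟨ interchange +-commutativeSemigroup (f 0) (h 0) F H ⟩
  f 0 + F + (h 0 + H)                                          ∎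
  where
  open ≡-Reasoning
  F = sum (applyUpTo (f ∘ suc) n)
  H = sum (applyUpTo (h ∘ suc) n)

sum-applyUpTo-* : ∀ c (f : ℕ → ℕ) n → sum (applyUpTo (λ i → c * f i) n) ≡ c * sum (applyUpTo f n)
sum-applyUpTo-* c f zero    = sym (*-zeroʳ c)
sum-applyUpTo-* c f (suc n) =
  trans (cong (c * f 0 +_) (sum-applyUpTo-* c (f ∘ suc) n)) (sym (*-distribˡ-+ c (f 0) _))

sum-applyUpTo-suc : ∀ (f : ℕ → ℕ) n → sum (applyUpTo f (suc n)) ≡ sum (applyUpTo f n) + f n
sum-applyUpTo-suc f n = begin
  sum (applyUpTo f (suc n))        ≡⟨ cong sum (applyUpTo-∷ʳ f n) ⟨
  sum (applyUpTo f n ++ [ f n ])   ≡⟨ sum-++ (applyUpTo f n) [ f n ] ⟩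
  sum (applyUpTo f n) + (f n + 0)  ≡⟨ cong (sum (applyUpTo f n) +_) (+-identityʳ (f n)) ⟩
  sum (applyUpTo f n) + f n        ∎
  where open ≡-Reasoning

sum-concat : ∀ (xss : List (List ℕ)) → sum (concat xss) ≡ sum (map sum xss)
sum-concat []         = refl
sum-concat (xs ∷ xss) = trans (sum-++ xs (concat xss)) (cong (sum xs +_) (sum-concat xss))

sum-map-applyUpTo : ∀ (h f : ℕ → ℕ) n → sum (map h (applyUpTo f n)) ≡ sum (applyUpTo (h ∘ f) n)
sum-map-applyUpTo h f n = cong sum (map-applyUpTo f h n)

-- ∑ᵃ n f sums f x x′ over the n pairs with x + x′ = n ∸ 1; in pCount below these are the
-- distances of a cell to two opposite edges of the bar.
∑ᵃ : ℕ → (ℕ → ℕ → ℕ) → ℕ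
∑ᵃ n f = sum (applyUpTo (λ x → f x (n ∸ suc x)) n)

+-regroup : ∀ a b {s x y} → s ≡ x + y → a + (b + s) ≡ (a + x) + (b + y)
+-regroup a b {x = x} {y} refl = trans (sym (+-assoc a b (x + y))) (interchange +-commutativeSemigroup a b x y)

∑ᵃ-split : ∀ μ k f → ∑ᵃ (μ ∷ᵇ k) f ≡
  ∑ᵃ (bit μ + k) (λ a a′ → f (false ∷ᵇ a) (not μ ∷ᵇ a′)) + ∑ᵃ k (λ a a′ → f (true ∷ᵇ a) (μ ∷ᵇ a′))
∑ᵃ-split false zero    f = refl
∑ᵃ-split true  zero    f = sym (+-identityʳ (f 0 0 + 0))
∑ᵃ-split false (suc k) f =
  +-regroup (f 0 (true ∷ᵇ k)) (f 1 (false ∷ᵇ k)) (∑ᵃ-split false k (λ x → f (suc (suc x))))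
∑ᵃ-split true  (suc k) f =
  +-regroup (f 0 (false ∷ᵇ suc k)) (f 1 (true ∷ᵇ k)) (∑ᵃ-split true k (λ x → f (suc (suc x))))

sum-applyUpTo-double : ∀ (f : ℕ → ℕ) n → sum (applyUpTo f (false ∷ᵇ n)) ≡
  sum (applyUpTo (λ i → f (false ∷ᵇ i)) n) + sum (applyUpTo (λ i → f (true ∷ᵇ i)) n)
sum-applyUpTo-double f n = ∑ᵃ-split false n (λ x _ → f x)

pCount : ℕ → ℕ → ℕ
pCount m n = ∑ᵃ m λ x x′ → ∑ᵃ n λ y y′ → pCell x y x′ y′

-- Opaque so that its instances stay folded: the implicit arguments of quadrant-parity
-- are then found by unification.
opaque
  quadrant : ℕ → ℕ → Bool → Bool → Bool → Bool → ℕ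
  quadrant m n α β γ δ = ∑ᵃ m λ a a′ → ∑ᵃ n λ b b′ → pCell (α ∷ᵇ a) (β ∷ᵇ b) (γ ∷ᵇ a′) (δ ∷ᵇ b′)

opaque
  unfolding quadrant

  pCount-split : ∀ μ ν k l → pCount (μ ∷ᵇ k) (ν ∷ᵇ l) ≡
      (quadrant (bit μ + k) (bit ν + l) false false (not μ) (not ν) + quadrant (bit μ + k) l false true (not μ) ν)
    + (quadrant k (bit ν + l) true false μ (not ν) + quadrant k l true true μ ν)
  pCount-split μ ν k l = trans
    (∑ᵃ-split μ k λ x x′ → ∑ᵃ (ν ∷ᵇ l) λ y y′ → pCell x y x′ y′)
    (cong₂ _+_ (split-columns (bit μ + k) false (not μ)) (split-columns k true μ))
    where
    split-columns : ∀ m α γ → (∑ᵃ m λ a a′ → ∑ᵃ (ν ∷ᵇ l) λ y y′ → pCell (α ∷ᵇ a) y (γ ∷ᵇ a′) y′) ≡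
                              quadrant m (bit ν + l) α false γ (not ν) + quadrant m l α true γ ν
    split-columns m α γ = trans
      (sum-applyUpTo-cong m λ a → ∑ᵃ-split ν l λ y y′ → pCell (α ∷ᵇ a) y (γ ∷ᵇ (m ∸ suc a)) y′)
      (sum-applyUpTo-+ _ _ m)

  quadrant-parity : ∀ {m n α β γ δ} → quadrant m n α β γ δ ≡ (if ((α xor β) xor γ) xor δ then 0 else pCount m n)
  quadrant-parity {m} {n} {α} {β} {γ} {δ} with ((α xor β) xor γ) xor δ in parity
  ... | true  = sum-applyUpTo-0 m λ a → sum-applyUpTo-0 n λ b →
    trans (pCell-∷ᵇ α β γ δ a b _ _) (cong (λ p → if p then 0 else _) parity)
  ... | false = sum-applyUpTo-cong m λ a → sum-applyUpTo-cong n λ b →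
    trans (pCell-∷ᵇ α β γ δ a b _ _) (cong (λ p → if p then 0 else _) parity)

pCount-∷ᵇ-same : ∀ μ k l → pCount (μ ∷ᵇ k) (μ ∷ᵇ l) ≡
  (pCount (bit μ + k) (bit μ + l) + pCount (bit μ + k) l) + (pCount k (bit μ + l) + pCount k l)
pCount-∷ᵇ-same false k l = trans (pCount-split false false k l)
  (cong₂ _+_ (cong₂ _+_ quadrant-parity quadrant-parity) (cong₂ _+_ quadrant-parity quadrant-parity))
pCount-∷ᵇ-same true  k l = trans (pCount-split true true k l)
  (cong₂ _+_ (cong₂ _+_ quadrant-parity quadrant-parity) (cong₂ _+_ quadrant-parity quadrant-parity))

pCount-∷ᵇ-not : ∀ μ k l → pCount (μ ∷ᵇ k) (not μ ∷ᵇ l) ≡ 0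
pCount-∷ᵇ-not false k l = trans (pCount-split false true k l)
  (cong₂ _+_ (cong₂ _+_ quadrant-parity quadrant-parity) (cong₂ _+_ quadrant-parity quadrant-parity))
pCount-∷ᵇ-not true  k l = trans (pCount-split true false k l)
  (cong₂ _+_ (cong₂ _+_ quadrant-parity quadrant-parity) (cong₂ _+_ quadrant-parity quadrant-parity))

pCount-suc-self : ∀ k → pCount (suc k) k ≡ 0
pCount-suc-self k with binary k
... | bin false j = pCount-∷ᵇ-not true j j
... | bin true  j = pCount-∷ᵇ-not false (suc j) j

pCount-self-suc : ∀ k → pCount k (suc k) ≡ 0
pCount-self-suc k with binary k
... | bin false j = pCount-∷ᵇ-not false j j
... | bin true  j = pCount-∷ᵇ-not true j (suc j)

g≡pCount : ∀ m → g m ≡ pCount m m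
g≡pCount m = begin
  sum (concat (map row (range1 m)))    ≡⟨ sum-concat (map row (range1 m)) ⟩
  sum (map sum (map row (range1 m)))   ≡⟨ cong sum (map-∘ (range1 m)) ⟨
  sum (map (sum ∘ row) (range1 m))     ≡⟨ sum-map-applyUpTo (sum ∘ row) suc m ⟩
  sum (applyUpTo (sum ∘ row ∘ suc) m)  ≡⟨ sum-applyUpTo-cong m (λ x → sum-map-applyUpTo _ suc m) ⟩
  pCount m m                           ∎
  where
  open ≡-Reasoning
  row : ℕ → List ℕ
  row i = map (λ j → if isP m i j then 1 else 0) (range1 m)

g-double : ∀ k → g (false ∷ᵇ k) ≡ 4 * g k
g-double k = begin
  g (false ∷ᵇ k)                                         ≡⟨ g≡pCount (false ∷ᵇ k) ⟩
  pCount (false ∷ᵇ k) (false ∷ᵇ k)                       ≡⟨ pCount-∷ᵇ-same false k k ⟩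
  (pCount k k + pCount k k) + (pCount k k + pCount k k)  ≡⟨ [p+p]+[p+p]≡4p (pCount k k) ⟩
  4 * pCount k k                                         ≡⟨ cong (4 *_) (g≡pCount k) ⟨
  4 * g k                                                ∎
  where
  open ≡-Reasoning
  [p+p]+[p+p]≡4p : ∀ p → (p + p) + (p + p) ≡ 4 * p
  [p+p]+[p+p]≡4p = solve-∀

g-suc-double : ∀ k → g (true ∷ᵇ k) ≡ g (suc k) + g k
g-suc-double k = begin
  g (true ∷ᵇ k)                                    ≡⟨ g≡pCount (true ∷ᵇ k) ⟩
  pCount (true ∷ᵇ k) (true ∷ᵇ k)                   ≡⟨ pCount-∷ᵇ-same true k k ⟩
  (G₁ + pCount (suc k) k) + (pCount k (suc k) + G₀) ≡⟨ cong₂ (λ s t → (G₁ + s) + (t + G₀)) (pCount-suc-self k) (pCount-self-suc k) ⟩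
  (G₁ + 0) + G₀                                    ≡⟨ cong (_+ G₀) (+-identityʳ G₁) ⟩
  G₁ + G₀                                          ≡⟨ cong₂ _+_ (g≡pCount (suc k)) (g≡pCount k) ⟨
  g (suc k) + g k                                  ∎
  where
  open ≡-Reasoning
  G₁ = pCount (suc k) (suc k)
  G₀ = pCount k k

g-sum : ℕ → ℕ
g-sum n = sum (applyUpTo g n)

g-odd-sum : ℕ → ℕ
g-odd-sum n = sum (applyUpTo (λ k → g (true ∷ᵇ k)) n)

g-odd-sum≡2*g-sum+g : ∀ n → g-odd-sum n ≡ 2 * g-sum n + g n
g-odd-sum≡2*g-sum+g n = begin
  g-odd-sum n                                ≡⟨ sum-applyUpTo-cong n g-suc-double ⟩
  sum (applyUpTo (λ k → g (suc k) + g k) n)  ≡⟨ sum-applyUpTo-+ (g ∘ suc) g n ⟩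
  -- g-sum (suc n) unfolds to g 0 + Σ_{k<n} g (suc k), and g 0 reduces to 0.
  g-sum (suc n) + g-sum n                    ≡⟨ cong (_+ g-sum n) (sum-applyUpTo-suc g n) ⟩
  (g-sum n + g n) + g-sum n                  ≡⟨ [s+x]+s≡2s+x (g-sum n) (g n) ⟩
  2 * g-sum n + g n                          ∎
  where
  open ≡-Reasoning
  [s+x]+s≡2s+x : ∀ s x → (s + x) + s ≡ 2 * s + x
  [s+x]+s≡2s+x = solve-∀

g-sum-double : ∀ n → g-sum (false ∷ᵇ n) ≡ 4 * g-sum n + g-odd-sum n
g-sum-double n = begin
  g-sum (false ∷ᵇ n)                                      ≡⟨ sum-applyUpTo-double g n ⟩
  sum (applyUpTo (λ k → g (false ∷ᵇ k)) n) + g-odd-sum n  ≡⟨ cong (_+ g-odd-sum n) (sum-applyUpTo-cong n g-double) ⟩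
  sum (applyUpTo (λ k → 4 * g k) n) + g-odd-sum n         ≡⟨ cong (_+ g-odd-sum n) (sum-applyUpTo-* 4 g n) ⟩
  4 * g-sum n + g-odd-sum n                               ∎
  where open ≡-Reasoning

g-odd-sum-double : ∀ n → g-odd-sum (false ∷ᵇ n) ≡ 6 * g-odd-sum n
g-odd-sum-double n = begin
  g-odd-sum (false ∷ᵇ n)                     ≡⟨ g-odd-sum≡2*g-sum+g (false ∷ᵇ n) ⟩
  2 * g-sum (false ∷ᵇ n) + g (false ∷ᵇ n)    ≡⟨ cong₂ (λ s t → 2 * s + t) (g-sum-double n) (g-double n) ⟩
  2 * (4 * S + O) + 4 * g n                  ≡⟨ regroup S O (g n) ⟩
  2 * O + 4 * (2 * S + g n)                  ≡⟨ cong (λ o → 2 * O + 4 * o) (g-odd-sum≡2*g-sum+g n) ⟨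
  2 * O + 4 * O                              ≡⟨ 2o+4o≡6o O ⟩
  6 * O                                      ∎
  where
  open ≡-Reasoning
  S = g-sum n
  O = g-odd-sum n
  regroup : ∀ s o x → 2 * (4 * s + o) + 4 * x ≡ 2 * o + 4 * (2 * s + x)
  regroup = solve-∀
  2o+4o≡6o : ∀ o → 2 * o + 4 * o ≡ 6 * o
  2o+4o≡6o = solve-∀

g-odd-sum-2^ : ∀ j → g-odd-sum (2 ^ j) ≡ 6 ^ j
g-odd-sum-2^ zero    = refl
g-odd-sum-2^ (suc j) = begin
  g-odd-sum (2 * 2 ^ j)         ≡⟨ cong g-odd-sum (double≡2* (2 ^ j)) ⟨
  g-odd-sum (false ∷ᵇ (2 ^ j))  ≡⟨ g-odd-sum-double (2 ^ j) ⟩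
  6 * g-odd-sum (2 ^ j)         ≡⟨ cong (6 *_) (g-odd-sum-2^ j) ⟩
  6 * 6 ^ j                     ∎
  where open ≡-Reasoning

theorem4 : (n : ℕ) → 1 ≤ n → sumFrom1 (2 ^ (n ∸ 1)) (λ m → g (2 * m ∸ 1)) ≡ 6 ^ (n ∸ 1)
theorem4 (suc j) _ = begin
  sumFrom1 (2 ^ j) (λ m → g (2 * m ∸ 1))             ≡⟨ sum-map-applyUpTo (λ m → g (2 * m ∸ 1)) suc (2 ^ j) ⟩
  sum (applyUpTo (λ k → g (2 * suc k ∸ 1)) (2 ^ j))  ≡⟨ sum-applyUpTo-cong (2 ^ j) (cong g ∘ 2[1+k]∸1≡true∷ᵇk) ⟩
  g-odd-sum (2 ^ j)                                  ≡⟨ g-odd-sum-2^ j ⟩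
  6 ^ j                                              ∎
  where
  open ≡-Reasoning
  2[1+k]∸1≡true∷ᵇk : ∀ k → 2 * suc k ∸ 1 ≡ true ∷ᵇ k
  2[1+k]∸1≡true∷ᵇk k = cong (_∸ 1) (sym (double≡2* (suc k)))
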